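{- Let $\mathbb X=(X_i)_{i\in\mathbb Z}$ be the gene associated to a coherent triple $(h,\gamma,\gamma')$. Then there exists an integer $i$ such that $X_i=\mathbf 0$ or $X_i\ne X_{i+f}$.
   Context: Let $p>2$ be a prime, $f\ge2$ an integer, $q=p^f$. A coherent triple is $(h,\gamma,\gamma')\in\mathbb Z/(q^2-1)\mathbb Z\times\mathbb Z/(q-1)\mathbb Z\times\mathbb Z/(q-1)\mathbb Z$ such that $h$ is not divisible by $q+1$ and $h\equiv\gamma+\gamma'+\frac{q-1}{p-1}\pmod{q-1}$. Gene of a coherent triple (values in the symbols $\{\mathbf A,\mathbf B,\mathbf{AB},\mathbf 0\}$). Fix integer representatives of $h,\gamma'$. Let $h_0,\dots,h_{f-1}\in\{0,\dots,p-1\}$ with $h\equiv 1+\sum_{i=0}^{f-1}h_ip^{f-1-i}\pmod{q+1}$, set $h_i=p-1-h_{i-f}$ for $f\le i\le 2f-1$, extend $2f$-periodically, and set $\iota_i=1$ if $h_i=p-1$, $\iota_i=0$ otherwise. Let $\nu=p^{f-1}+\dots+p$. For $0\le i\le 2f-1$ let $\alpha_i\in\{0,\dots,q-2\}$ with $\alpha_i\equiv\lfloor p^ih/(q+1)\rfloor-p^i\gamma'\pmod{q-1}$, and set $X_i=\mathbf A$ if $\alpha_i<\frac1p\nu+\iota_{i+f}$; $X_i=\mathbf{AB}$ if $\frac1p\nu+\iota_{i+f}\le\alpha_i\le\frac{p-1}{p}\nu-\iota_i$; $X_i=\mathbf B$ if $\frac{p-1}p\nu-\iota_i<\alpha_i\le\nu$;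 $X_i=\mathbf 0$ if $\alpha_i>\nu$; extend $2f$-periodically. -}

module Defs where

open import Data.Nat as ℕ using (ℕ; zero; suc; _+_; _*_; _∸_; _^_; _<_; _≤_; _<ᵇ_; _≤ᵇ_; _≡ᵇ_)
open import Data.Bool using (Bool; true; false; if_then_else_; _∧_)
open import Data.Integer as ℤ using (ℤ; +_)
import Data.Integer.DivMod as ℤDM
open import Data.Nat.Divisibility using (_∣_)
open import Data.Product using (_×_)
open import Relation.Binary.PropositionalEquality using (_≡_)
open import Relation.Nullary using (¬_)

infixl 7 _modℤ_ _modℕ_ _divℕ_

-- Total versions of mod / div (the zero-divisor case is never used:
-- all divisors below are ≥ 2 under the standing hypotheses).
_modℤ_ : ℤ → ℕ → ℕ
z modℤ zero    = 0
z modℤ (suc n) = z ℤDM.%ℕ suc n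

_modℕ_ : ℕ → ℕ → ℕ
a modℕ zero    = a
a modℕ (suc n) = a ℕ.% suc n

_divℕ_ : ℕ → ℕ → ℕ
a divℕ zero    = 0
a divℕ (suc n) = a ℕ./ suc n

geom : ℕ → ℕ → ℕ
geom p zero    = 0
geom p (suc n) = geom p n + p ^ n

module Gene (p f : ℕ) where
  q : ℕ
  q = p ^ f

  -- (q-1)/(p-1) = 1 + p + ... + p^{f-1}
  qp : ℕ
  qp = geom p f

  ν : ℕ
  ν = geom p f ∸ 1

  -- Coherent triple, with h, γ, γ' given by their canonical representatives
  Coherent : ℕ → ℕ → ℕ → Set
  Coherent h γ γ' =
    (h < q * q ∸ 1) × (γ < q ∸ 1) × (γ' < q ∸ 1) ×
    (¬ (suc q ∣ h)) × (h modℕ (q ∸ 1) ≡ (γ + γ' + qp) modℕ (q ∸ 1))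

  module _ (h γ' : ℕ) where
    -- digits h_0..h_{f-1} with h ≡ 1 + Σ h_j p^{f-1-j} (mod q+1)
    digit : ℕ → ℕ
    digit j = (((h modℕ suc q) ∸ 1) divℕ (p ^ (f ∸ 1 ∸ j))) modℕ p

    hh₀ : ℕ → ℕ
    hh₀ i = if i <ᵇ f then digit i else (p ∸ 1 ∸ digit (i ∸ f))

    -- 2f-periodic extension (indices in ℕ suffice for the use below)
    hh : ℕ → ℕ
    hh i = hh₀ (i modℕ (2 * f))

    ι : ℕ → ℕ
    ι i = if hh i ≡ᵇ (p ∸ 1) then 1 else 0

    α : ℕ → ℕ
    α i = (+ ((p ^ i * h) divℕ suc q) ℤ.- + (p ^ i * γ')) modℤ (q ∸ 1)

  data Sym : Set where
    A B AB O : Sym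

  module _ (h γ' : ℕ) where
    -- X_i for 0 ≤ i ≤ 2f-1; the thresholds ν/p + ι, (p-1)ν/p - ι are
    -- compared after multiplying by p (ν is divisible by p).
    X₀ : ℕ → Sym
    X₀ i =
      let a  = α h γ' i
          ιi = ι h γ' i
          ιf = ι h γ' (i + f)
      in if (p * a) <ᵇ (ν + p * ιf) then A
         else if (p * a + p * ιi) ≤ᵇ ((p ∸ 1) * ν) then AB
         else if a ≤ᵇ ν then B
         else O

    X : ℤ → Sym
    X i = X₀ (i modℤ (2 * f))

-- Let K = q - 1 and βᵢ = ⌊pⁱ h / (q + 1)⌋. Then β (i + 1) = p βᵢ + hᵢ for i < 2f and
-- β (2f) = K h + β 0, so the residues αᵢ ≡ βᵢ - pⁱ γ' (mod K) satisfy
-- α (i + 1) = p αᵢ + hᵢ - K εᵢ for an integer carry εᵢ. The thresholds defining Xᵢ put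
-- p αᵢ + hᵢ in [0, K) for A and AB and in [K, 2K) for B, so a letter Xᵢ ≠ 0 determines εᵢ.
-- If Xᵢ = X (i + f) ≠ 0 for every i < f, the carries are f-periodic; writing
-- βᵢ - pⁱ γ' = αᵢ + K mᵢ this gives m (j + f) - m j = pʲ (m f - m 0), and α (2f) = α 0 then
-- forces h = (q + 1) (γ' + m f - m 0), contradicting (q + 1) ∤ h.
module Submission where

open import Defs

module GeneCarries where
  open import Data.Bool using (true; false; if_then_else_; T)
  open import Data.Empty using (⊥; ⊥-elim)
  open import Data.Integer as ℤ using (ℤ; +_; -[1+_]; 0ℤ; 1ℤ)
    renaming (_+_ to _+ᶻ_; _-_ to _-ᶻ_; _*_ to _*ᶻ_)
  import Data.Integer.DivMod as ℤD
  import Data.Integer.Properties as ℤP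
  open import Data.Integer.Tactic.RingSolver using () renaming (solve-∀ to solveᶻ)
  open import Data.Nat
  open import Data.Nat.Coprimality using (Coprime; coprime-divisor)
  open import Data.Nat.DivMod
  open import Data.Nat.Divisibility
  open import Data.Nat.Properties
  open import Data.Nat.Tactic.RingSolver using (solve-∀)
  open import Data.Product using (∃-syntax; _×_; _,_)
  open import Data.Sum using (_⊎_; inj₁; inj₂)
  open import Function using (_∘_; mk↣)
  open import Relation.Binary.Definitions using (DecidableEquality)
  open import Relation.Binary.PropositionalEquality
  open import Relation.Nullary using (¬_; yes; no; contradiction)
  open import Relation.Nullary.Decidable using (_⊎-dec_; ¬?; decidable-stable)

  [m*n+o]/n≡m : ∀ m {n o} .{{_ : NonZero n}} → o < n → (m * n + o) / n ≡ m
  [m*n+o]/n≡m m {n} {o} o<n = begin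
    (m * n + o) / n    ≡⟨ +-distrib-/-∣ˡ o (n∣m*n m) ⟩
    m * n / n + o / n  ≡⟨ cong₂ _+_ (m*n/n≡m m n) (m<n⇒m/n≡0 o<n) ⟩
    m + 0              ≡⟨ +-identityʳ m ⟩
    m                  ∎
    where open ≡-Reasoning

  -- With N = b (q+1) + (s+1) and s < q one has q N = (q b + s) (q+1) + (q - s).
  quotient-complement : ∀ q N → ¬ (suc q ∣ N) → q * N / suc q + N / suc q + 1 ≡ N
  quotient-complement q N q+1∤N
    with N % suc q | m%n<n N (suc q) | m≡m%n+[m/n]*n N (suc q)
  ... | zero  | _   | N≡ = contradiction (divides (N / suc q) N≡) q+1∤N
  ... | suc s | 1+s<1+q | N≡ with m≤n⇒∃[o]m+o≡n (s≤s⁻¹ (<⇒≤ 1+s<1+q))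
  ... | u , refl = begin
    (s + u) * N / suc (s + u) + b + 1  ≡⟨ cong (λ n → n + b + 1) qN/q+1 ⟩
    (s + u) * b + s + b + 1            ≡⟨ regroup s u b ⟩
    suc s + b * suc (s + u)            ≡⟨ N≡ ⟨
    N                                  ∎
    where
    open ≡-Reasoning
    regroup : ∀ s u b → (s + u) * b + s + b + 1 ≡ suc s + b * suc (s + u)
    regroup = solve-∀
    qN-expanded : ∀ s u b → (s + u) * (suc s + b * suc (s + u)) ≡ ((s + u) * b + s) * suc (s + u) + u
    qN-expanded = solve-∀
    b : ℕ
    b = N / suc (s + u)
    qN/q+1 : (s + u) * N / suc (s + u) ≡ (s + u) * b + s
    qN/q+1 = begin
      (s + u) * N / suc (s + u)
        ≡⟨ /-congˡ (cong ((s + u) *_) N≡) ⟩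
      (s + u) * (suc s + b * suc (s + u)) / suc (s + u)
        ≡⟨ /-congˡ (qN-expanded s u b) ⟩
      (((s + u) * b + s) * suc (s + u) + u) / suc (s + u)
        ≡⟨ [m*n+o]/n≡m ((s + u) * b + s) (s≤s (m≤n+m u s)) ⟩
      (s + u) * b + s ∎

  -- With ρ = g D + s and s < D, the remainder is a (s + 1) - g, which is at most a D since g < a.
  quotient-scaled : ∀ {q} a D k ρ .{{_ : NonZero D}} → a * D ≡ q → ρ < q →
                    a * (suc q * k + suc ρ) / suc q ≡ a * k + ρ / D
  quotient-scaled a D k ρ refl ρ<aD = begin
    a * (suc (a * D) * k + suc ρ) / suc (a * D)    ≡⟨ /-congˡ division ⟩
    ((a * k + g) * suc (a * D) + r) / suc (a * D)  ≡⟨ [m*n+o]/n≡m (a * k + g) (s≤s r≤aD) ⟩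
    a * k + g                                      ∎
    where
    open ≡-Reasoning
    s g r : ℕ
    s = ρ % D
    g = ρ / D
    r = a * suc s ∸ g
    g<a : g < a
    g<a = *-cancelʳ-< D g a (≤-<-trans (m/n*n≤m ρ D) ρ<aD)
    r+g≡a[1+s] : r + g ≡ a * suc s
    r+g≡a[1+s] = m∸n+n≡m (≤-trans (<⇒≤ g<a) (m≤m*n a (suc s)))
    r≤aD : r ≤ a * D
    r≤aD = ≤-trans (m∸n≤m (a * suc s) g) (*-monoʳ-≤ a (m%n<n ρ D))
    expand : ∀ a D k s g →
             a * (suc (a * D) * k + suc (s + g * D)) + g ≡ (a * k + g) * suc (a * D) + a * suc s
    expand = solve-∀
    division : a * (suc (a * D) * k + suc ρ) ≡ (a * k + g) * suc (a * D) + r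
    division = +-cancelʳ-≡ g _ _ (begin
      a * (suc (a * D) * k + suc ρ) + g
        ≡⟨ cong (λ n → a * (suc (a * D) * k + suc n) + g) (m≡m%n+[m/n]*n ρ D) ⟩
      a * (suc (a * D) * k + suc (s + g * D)) + g  ≡⟨ expand a D k s g ⟩
      (a * k + g) * suc (a * D) + a * suc s        ≡⟨ cong (λ n → (a * k + g) * suc (a * D) + n) r+g≡a[1+s] ⟨
      (a * k + g) * suc (a * D) + (r + g)          ≡⟨ +-assoc _ r g ⟨
      (a * k + g) * suc (a * D) + r + g            ∎)

  pos-*+ : ∀ k n a → + (k * n + a) ≡ + k *ᶻ + n +ᶻ + a
  pos-*+ k n a = trans (ℤP.pos-+ (k * n) a) (cong (_+ᶻ + a) (ℤP.pos-* k n))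

  carry-zero : ∀ {K a y} e → a < K → y < K → + a ≡ + y -ᶻ + K *ᶻ e → e ≡ 0ℤ
  carry-zero (+ zero) _ _ _ = refl
  carry-zero {K} {a} {y} (+ suc n) _ y<K a≡ =
    contradiction (subst (K ≤_) (sym y≡) (≤-trans (m≤m*n K (suc n)) (m≤m+n _ a))) (<⇒≱ y<K)
    where
    cancel : ∀ y z → y ≡ (y -ᶻ z) +ᶻ z
    cancel = solveᶻ
    y≡ : y ≡ K * suc n + a
    y≡ = ℤP.+-injective (begin
      + y                                   ≡⟨ cancel (+ y) (+ K *ᶻ + suc n) ⟩
      (+ y -ᶻ + K *ᶻ + suc n) +ᶻ + K *ᶻ + suc n ≡⟨ cong (_+ᶻ + K *ᶻ + suc n) a≡ ⟨
      + a +ᶻ + K *ᶻ + suc n                 ≡⟨ ℤP.+-comm (+ a) (+ K *ᶻ + suc n) ⟩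
      + K *ᶻ + suc n +ᶻ + a                 ≡⟨ pos-*+ K (suc n) a ⟨
      + (K * suc n + a)                     ∎)
      where open ≡-Reasoning
  carry-zero {K} {a} {y} -[1+ n ] a<K _ a≡ =
    contradiction (subst (K ≤_) (sym a≡′) (≤-trans (m≤m*n K (suc n)) (m≤m+n _ y))) (<⇒≱ a<K)
    where
    negate : ∀ y k n → y -ᶻ k *ᶻ ℤ.- n ≡ k *ᶻ n +ᶻ y
    negate = solveᶻ
    a≡′ : a ≡ K * suc n + y
    a≡′ = ℤP.+-injective (trans a≡ (trans (negate (+ y) (+ K) (+ suc n)) (sym (pos-*+ K (suc n) y))))

  carry-one : ∀ {K a y} e → a < K → K ≤ y → y < K + K → + a ≡ + y -ᶻ + K *ᶻ e → e ≡ 1ℤ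
  carry-one {K} {a} {y} e a<K K≤y y<2K a≡ = begin
    e                  ≡⟨ pred-suc e ⟩
    (e -ᶻ 1ℤ) +ᶻ 1ℤ    ≡⟨ cong (_+ᶻ 1ℤ) (carry-zero (e -ᶻ 1ℤ) a<K y∸K<K a≡′) ⟩
    1ℤ                 ∎
    where
    open ≡-Reasoning
    pred-suc : ∀ e → e ≡ (e -ᶻ 1ℤ) +ᶻ 1ℤ
    pred-suc = solveᶻ
    y∸K+K≡y : y ∸ K + K ≡ y
    y∸K+K≡y = m∸n+n≡m K≤y
    y∸K<K : y ∸ K < K
    y∸K<K = +-cancelʳ-< K (y ∸ K) K (subst (_< K + K) (sym y∸K+K≡y) y<2K)
    shift : ∀ y k e → (y +ᶻ k) -ᶻ k *ᶻ e ≡ y -ᶻ k *ᶻ (e -ᶻ 1ℤ)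
    shift = solveᶻ
    a≡′ : + a ≡ + (y ∸ K) -ᶻ + K *ᶻ (e -ᶻ 1ℤ)
    a≡′ = begin
      + a                              ≡⟨ a≡ ⟩
      + y -ᶻ + K *ᶻ e                  ≡⟨ cong (λ n → + n -ᶻ + K *ᶻ e) y∸K+K≡y ⟨
      + (y ∸ K + K) -ᶻ + K *ᶻ e        ≡⟨ cong (_-ᶻ + K *ᶻ e) (ℤP.pos-+ (y ∸ K) K) ⟩
      (+ (y ∸ K) +ᶻ + K) -ᶻ + K *ᶻ e   ≡⟨ shift (+ (y ∸ K)) (+ K) e ⟩
      + (y ∸ K) -ᶻ + K *ᶻ (e -ᶻ 1ℤ)    ∎

  divℕ≡/ : ∀ a n .{{_ : NonZero n}} → a divℕ n ≡ a / n
  divℕ≡/ a (suc n) = refl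

  modℤ≡%ℕ : ∀ z n .{{_ : NonZero n}} → z modℤ n ≡ z ℤD.%ℕ n
  modℤ≡%ℕ z (suc n) = refl

  geom-closed : ∀ P n → geom (suc P) n * P + 1 ≡ suc P ^ n
  geom-closed P zero    = refl
  geom-closed P (suc n) = begin
    (geom p n + p ^ n) * P + 1    ≡⟨ regroup (geom p n) (p ^ n) P ⟩
    (geom p n * P + 1) + p ^ n * P ≡⟨ cong (_+ p ^ n * P) (geom-closed P n) ⟩
    p ^ n + p ^ n * P             ≡⟨ cong (λ x → p ^ n + x) (*-comm (p ^ n) P) ⟩
    p ^ suc n                     ∎
    where
    open ≡-Reasoning
    p = suc P
    regroup : ∀ g x P → (g + x) * P + 1 ≡ (g * P + 1) + x * P
    regroup = solve-∀

  geom-positive : ∀ p n .{{_ : NonZero p}} → 1 ≤ n → 1 ≤ geom p n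
  geom-positive p (suc n) _ = ≤-trans (m^n>0 p n) (m≤n+m (p ^ n) (geom p n))

  if-true : ∀ {A : Set} {b} {x y : A} → T b → (if b then x else y) ≡ x
  if-true {b = true} _ = refl

  if-false : ∀ {A : Set} {b} {x y : A} → ¬ T b → (if b then x else y) ≡ y
  if-false {b = false} _  = refl
  if-false {b = true}  ¬t = contradiction _ ¬t

  ∣n⇒coprime-1+n : ∀ {m n} → m ∣ n → Coprime (suc n) m
  ∣n⇒coprime-1+n {m} {n} m∣n {d} (d∣1+n , d∣m) =
    ∣1⇒≡1 (∣m+n∣m⇒∣n (subst (d ∣_) (+-comm 1 n) d∣1+n) (∣-trans d∣m m∣n))

  drift-step : ∀ z a b c d → b -ᶻ z *ᶻ a ≡ d -ᶻ z *ᶻ c → d -ᶻ b ≡ z *ᶻ (c -ᶻ a)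
  drift-step z a b c d b-za≡d-zc = begin
    d -ᶻ b                                               ≡⟨ split z a b c d ⟩
    z *ᶻ (c -ᶻ a) -ᶻ ((b -ᶻ z *ᶻ a) -ᶻ (d -ᶻ z *ᶻ c))    ≡⟨ cong (λ w → z *ᶻ (c -ᶻ a) -ᶻ (w -ᶻ (d -ᶻ z *ᶻ c))) b-za≡d-zc ⟩
    z *ᶻ (c -ᶻ a) -ᶻ ((d -ᶻ z *ᶻ c) -ᶻ (d -ᶻ z *ᶻ c))    ≡⟨ cancel (z *ᶻ (c -ᶻ a)) (d -ᶻ z *ᶻ c) ⟩
    z *ᶻ (c -ᶻ a)                                        ∎
    where
    open ≡-Reasoning
    split : ∀ z a b c d → d -ᶻ b ≡ z *ᶻ (c -ᶻ a) -ᶻ ((b -ᶻ z *ᶻ a) -ᶻ (d -ᶻ z *ᶻ c))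
    split = solveᶻ
    cancel : ∀ x y → x -ᶻ (y -ᶻ y) ≡ x
    cancel = solveᶻ

  module _ (P F : ℕ) (2≤P : 2 ≤ P) (1≤F : 1 ≤ F) where
    private
      p f : ℕ
      p = suc P
      f = suc F

    open Gene p f

    K : ℕ
    K = q ∸ 1

    q≡1+K : q ≡ suc K
    q≡1+K = sym (m+[n∸m]≡n (m^n>0 p f))

    1+ν≡geom : suc ν ≡ geom p f
    1+ν≡geom = m+[n∸m]≡n (geom-positive p f (s≤s z≤n))

    K≡Pν+P : K ≡ P * ν + P
    K≡Pν+P = suc-injective (begin
      suc K             ≡⟨ q≡1+K ⟨
      q                 ≡⟨ geom-closed P f ⟨
      geom p f * P + 1  ≡⟨ cong (λ g → g * P + 1) 1+ν≡geom ⟨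
      suc ν * P + 1     ≡⟨ regroup ν P ⟩
      suc (P * ν + P)   ∎)
      where
      open ≡-Reasoning
      regroup : ∀ ν P → suc ν * P + 1 ≡ suc (P * ν + P)
      regroup = solve-∀

    instance
      K≢0 : NonZero K
      K≢0 = >-nonZero (subst (0 <_) (sym K≡Pν+P) (≤-trans (≤-trans (s≤s z≤n) 2≤P) (m≤n+m P (P * ν))))

    q≡Pν+p : q ≡ P * ν + p
    q≡Pν+p = trans q≡1+K (trans (cong suc K≡Pν+P) (sym (+-suc (P * ν) P)))

    ν+p≤K : ν + p ≤ K
    ν+p≤K = begin
      ν + p        ≡⟨ +-suc ν P ⟩
      suc ν + P    ≤⟨ +-monoˡ-≤ P 1+ν≤Pν ⟩
      P * ν + P    ≡⟨ K≡Pν+P ⟨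
      K            ∎
      where
      open ≤-Reasoning
      1≤ν : 1 ≤ ν
      1≤ν = s≤s⁻¹ (subst (2 ≤_) (sym 1+ν≡geom) (+-mono-≤ (geom-positive p F 1≤F) (m^n>0 p F)))
      1+ν≤Pν : suc ν ≤ P * ν
      1+ν≤Pν = begin
        suc ν        ≤⟨ +-monoˡ-≤ ν 1≤ν ⟩
        ν + ν        ≡⟨ cong (λ n → ν + n) (+-identityʳ ν) ⟨
        2 * ν        ≤⟨ *-monoˡ-≤ ν 2≤P ⟩
        P * ν        ∎

    pν+P<K+K : p * ν + P < K + K
    pν+P<K+K = begin-strict
      p * ν + P         ≡⟨ regroup P ν ⟩
      ν + (P * ν + P)   ≡⟨ cong (λ n → ν + n) K≡Pν+P ⟨
      ν + K             <⟨ +-monoˡ-< K (<-≤-trans (m<m+n ν z<s) ν+p≤K) ⟩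
      K + K             ∎
      where
      open ≤-Reasoning
      regroup : ∀ P ν → suc P * ν + P ≡ ν + (P * ν + P)
      regroup = solve-∀

    Pν<ps⇒q≤ps : ∀ s → P * ν < p * s → q ≤ p * s
    Pν<ps⇒q≤ps s Pν<ps = *-monoʳ-≤ p (s≤s⁻¹ (*-cancelˡ-< p (p ^ F) (suc s) (begin-strict
      p * p ^ F         ≡⟨ q≡Pν+p ⟩
      P * ν + p         ≡⟨ +-suc (P * ν) P ⟩
      suc (P * ν) + P   ≤⟨ +-monoˡ-≤ P Pν<ps ⟩
      p * s + P         <⟨ +-monoʳ-< (p * s) (n<1+n P) ⟩
      p * s + p         ≡⟨ +-comm (p * s) p ⟩
      p + p * s         ≡⟨ *-suc p s ⟨
      p * suc s         ∎)))
      where open ≤-Reasoning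

    top : ℕ → ℕ
    top c = if c ≡ᵇ P then 1 else 0

    top-spec : ∀ c → (c ≡ P × top c ≡ 1) ⊎ (c ≢ P × top c ≡ 0)
    top-spec c with c ≡ᵇ P in c≟P
    ... | true  = inj₁ (≡ᵇ⇒≡ c P (subst T (sym c≟P) _) , refl)
    ... | false = inj₂ ((λ c≡P → subst T c≟P (≡⇒≡ᵇ c P c≡P)) , refl)

    p*top[c′]+c≤p : ∀ c c′ → c + c′ ≡ P → p * top c′ + c ≤ p
    p*top[c′]+c≤p c c′ c+c′≡P with top-spec c′
    ... | inj₁ (c′≡P , t≡1) rewrite t≡1 | +-cancelʳ-≡ P c 0 (trans (cong (λ x → c + x) (sym c′≡P)) c+c′≡P) =
      ≤-reflexive (trans (+-identityʳ (p * 1)) (*-identityʳ p))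
    ... | inj₂ (_ , t≡0) rewrite t≡0 | *-zeroʳ p = m≤n⇒m≤1+n (m+n≤o⇒m≤o c (≤-reflexive c+c′≡P))

    c<p*top[c]+P : ∀ c c′ → c + c′ ≡ P → c < p * top c + P
    c<p*top[c]+P c c′ c+c′≡P with top-spec c
    ... | inj₁ (c≡P , t≡1) rewrite t≡1 | c≡P = m<n+m P z<s
    ... | inj₂ (c≢P , t≡0) rewrite t≡0 | *-zeroʳ p = ≤∧≢⇒< (m+n≤o⇒m≤o c (≤-reflexive c+c′≡P)) c≢P

    p*top[c]≤1+c : ∀ c → p * top c ≤ suc c
    p*top[c]≤1+c c with top-spec c
    ... | inj₁ (c≡P , t≡1) rewrite t≡1 | *-identityʳ p | c≡P = ≤-refl
    ... | inj₂ (_ , t≡0) rewrite t≡0 | *-zeroʳ p = z≤n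

    -- X₀ h γ' i unfolds to classify (α h γ' i) (top (hh h γ' i)) (top (hh h γ' (i + f))).
    classify : ℕ → ℕ → ℕ → Sym
    classify a t t′ =
      if p * a <ᵇ ν + p * t′ then A
      else if p * a + p * t ≤ᵇ P * ν then AB
      else if a ≤ᵇ ν then B
      else O

    CarryRange : Sym → ℕ → Set
    CarryRange A  y = y < K
    CarryRange AB y = y < K
    CarryRange B  y = K ≤ y × y < K + K
    CarryRange O  _ = ⊥

    Pν<pa+p*top[c]⇒K≤pa+c : ∀ a c → P * ν < p * a + p * top c → K ≤ p * a + c
    Pν<pa+p*top[c]⇒K≤pa+c a c Pν< = s≤s⁻¹ (begin
      suc K              ≡⟨ q≡1+K ⟨
      q                  ≤⟨ Pν<ps⇒q≤ps (a + top c) (subst (P * ν <_) (sym (*-distribˡ-+ p a (top c))) Pν<) ⟩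
      p * (a + top c)    ≡⟨ *-distribˡ-+ p a (top c) ⟩
      p * a + p * top c  ≤⟨ +-monoʳ-≤ (p * a) (p*top[c]≤1+c c) ⟩
      p * a + suc c      ≡⟨ +-suc (p * a) c ⟩
      suc (p * a + c)    ∎)
      where open ≤-Reasoning

    classify-range : ∀ a c c′ → c + c′ ≡ P → classify a (top c) (top c′) ≢ O →
                     CarryRange (classify a (top c) (top c′)) (p * a + c)
    classify-range a c c′ c+c′≡P ≢O with p * a <ᵇ ν + p * top c′ in isA
    ... | true = begin-strict
      p * a + c              <⟨ +-monoˡ-< c (<ᵇ⇒< _ _ (subst T (sym isA) _)) ⟩
      ν + p * top c′ + c     ≡⟨ +-assoc ν (p * top c′) c ⟩
      ν + (p * top c′ + c)   ≤⟨ +-monoʳ-≤ ν (p*top[c′]+c≤p c c′ c+c′≡P) ⟩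
      ν + p                  ≤⟨ ν+p≤K ⟩
      K                      ∎
      where open ≤-Reasoning
    ... | false with p * a + p * top c ≤ᵇ P * ν in isAB
    ...   | true = begin-strict
      p * a + c                <⟨ +-monoʳ-< (p * a) (c<p*top[c]+P c c′ c+c′≡P) ⟩
      p * a + (p * top c + P)  ≡⟨ +-assoc (p * a) (p * top c) P ⟨
      p * a + p * top c + P    ≤⟨ +-monoˡ-≤ P (≤ᵇ⇒≤ _ _ (subst T (sym isAB) _)) ⟩
      P * ν + P                ≡⟨ K≡Pν+P ⟨
      K                        ∎
      where open ≤-Reasoning
    ...   | false with a ≤ᵇ ν in isB
    ...     | false = contradiction refl ≢O
    ...     | true  = Pν<pa+p*top[c]⇒K≤pa+c a c Pν< , (begin-strict
      p * a + c   ≤⟨ +-mono-≤ (*-monoʳ-≤ p (≤ᵇ⇒≤ a ν (subst T (sym isB) _))) (m+n≤o⇒m≤o c (≤-reflexive c+c′≡P)) ⟩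
      p * ν + P   <⟨ pν+P<K+K ⟩
      K + K       ∎)
      where
      open ≤-Reasoning
      Pν< : P * ν < p * a + p * top c
      Pν< = ≰⇒> (λ le → subst T isAB (≤⇒≤ᵇ le))

    _≟ˢ_ : DecidableEquality Sym
    _≟ˢ_ = eq? (mk↣ λ {s} {t} e → trans (sym (decode-encode s)) (trans (cong decode e) (decode-encode t)))
      where
      encode : Sym → ℕ
      encode A  = 0
      encode B  = 1
      encode AB = 2
      encode O  = 3
      decode : ℕ → Sym
      decode 0 = A
      decode 1 = B
      decode 2 = AB
      decode _ = O
      decode-encode : ∀ s → decode (encode s) ≡ s
      decode-encode A  = refl
      decode-encode B  = refl
      decode-encode AB = refl
      decode-encode O  = refl

    symbolCarry : Sym → ℤ
    symbolCarry B = 1ℤ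
    symbolCarry _ = 0ℤ

    carry-of-range : ∀ s {y a} e → CarryRange s y → a < K → + a ≡ + y -ᶻ + K *ᶻ e → e ≡ symbolCarry s
    carry-of-range A  e y<K            a<K = carry-zero e a<K y<K
    carry-of-range AB e y<K            a<K = carry-zero e a<K y<K
    carry-of-range B  e (K≤y , y<K+K) a<K = carry-one e a<K K≤y y<K+K

    <f⇒<2f : ∀ {i} → i < f → i < 2 * f
    <f⇒<2f i<f = <-≤-trans i<f (m≤m+n f (f + 0))

    <f⇒+f<2f : ∀ {i} → i < f → i + f < 2 * f
    <f⇒+f<2f i<f = <-≤-trans (+-monoˡ-< f i<f) (+-monoʳ-≤ f (m≤m+n f 0))

    p^i*p^[f∸i]≡q : ∀ {i} → i ≤ f → p ^ i * p ^ (f ∸ i) ≡ q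
    p^i*p^[f∸i]≡q {i} i≤f = trans (sym (^-distribˡ-+-* p i (f ∸ i))) (cong (p ^_) (m+[n∸m]≡n i≤f))

    module _ (h γ' : ℕ) (q+1∤h : ¬ (suc q ∣ h)) where

      β : ℕ → ℕ
      β i = p ^ i * h / suc q

      q+1∤p^ih : ∀ {i} → i ≤ f → ¬ (suc q ∣ p ^ i * h)
      q+1∤p^ih {i} i≤f = q+1∤h ∘ coprime-divisor (∣n⇒coprime-1+n p^i∣q)
        where
        p^i∣q : p ^ i ∣ q
        p^i∣q = divides (p ^ (f ∸ i)) (trans (sym (p^i*p^[f∸i]≡q i≤f)) (*-comm (p ^ i) _))

      β-complement : ∀ {i} → i ≤ f → β (i + f) + β i + 1 ≡ p ^ i * h
      β-complement {i} i≤f = begin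
        β (i + f) + β i + 1                ≡⟨ cong (λ n → n / suc q + β i + 1) p^[i+f]h≡ ⟩
        q * (p ^ i * h) / suc q + β i + 1  ≡⟨ quotient-complement q (p ^ i * h) (q+1∤p^ih i≤f) ⟩
        p ^ i * h                          ∎
        where
        open ≡-Reasoning
        p^[i+f]h≡ : p ^ (i + f) * h ≡ q * (p ^ i * h)
        p^[i+f]h≡ = trans (cong (_* h) (trans (^-distribˡ-+-* p i f) (*-comm (p ^ i) q)))
                          (*-assoc q (p ^ i) h)

      β-double : β (f + f) ≡ K * h + β 0
      β-double = +-cancelʳ-≡ h _ _ (begin
        β (f + f) + h                  ≡⟨ cong (λ n → β (f + f) + n) (trans (β-complement z≤n) (*-identityˡ h)) ⟨
        β (f + f) + (β f + β 0 + 1)    ≡⟨ regroup (β (f + f)) (β f) (β 0) ⟩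
        β (f + f) + β f + 1 + β 0      ≡⟨ cong (_+ β 0) (β-complement ≤-refl) ⟩
        q * h + β 0                    ≡⟨ cong (λ n → n * h + β 0) q≡1+K ⟩
        suc K * h + β 0                ≡⟨ regroup′ K h (β 0) ⟩
        K * h + β 0 + h                ∎)
        where
        open ≡-Reasoning
        regroup : ∀ a b c → a + (b + c + 1) ≡ a + b + 1 + c
        regroup = solve-∀
        regroup′ : ∀ K h b → suc K * h + b ≡ K * h + b + h
        regroup′ = solve-∀

      k ρ : ℕ
      k = h / suc q
      ρ = h % suc q ∸ 1

      1+ρ≡h%[1+q] : suc ρ ≡ h % suc q
      1+ρ≡h%[1+q] with h % suc q | m≡m%n+[m/n]*n h (suc q)
      ... | zero  | h≡ = contradiction (divides k h≡) q+1∤h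
      ... | suc _ | _  = refl

      h≡ : h ≡ suc q * k + suc ρ
      h≡ = begin
        h                  ≡⟨ m≡m%n+[m/n]*n h (suc q) ⟩
        h % suc q + k * suc q  ≡⟨ cong₂ _+_ (sym 1+ρ≡h%[1+q]) (*-comm k (suc q)) ⟩
        suc ρ + suc q * k  ≡⟨ +-comm (suc ρ) (suc q * k) ⟩
        suc q * k + suc ρ  ∎
        where open ≡-Reasoning

      ρ<q : ρ < q
      ρ<q = s≤s⁻¹ (subst (_< suc q) (sym 1+ρ≡h%[1+q]) (m%n<n h (suc q)))

      β-closed : ∀ {i} → i ≤ f → β i ≡ p ^ i * k + (ρ / p ^ (f ∸ i)) {{m^n≢0 p (f ∸ i)}}
      β-closed {i} i≤f = trans (cong (λ n → p ^ i * n / suc q) h≡)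
        (quotient-scaled (p ^ i) (p ^ (f ∸ i)) k ρ {{m^n≢0 p (f ∸ i)}} (p^i*p^[f∸i]≡q i≤f) ρ<q)

      β-digit-step : ∀ {i} → i < f → β (suc i) ≡ p * β i + digit h γ' i
      β-digit-step {i} (s≤s i≤F) = begin
        β (suc i)                                    ≡⟨ β-closed (s≤s i≤F) ⟩
        p ^ suc i * k + ρ / E                        ≡⟨ cong (λ n → p ^ suc i * k + n) (m≡m%n+[m/n]*n (ρ / E) p) ⟩
        p ^ suc i * k + (ρ / E % p + ρ / E / p * p)  ≡⟨ cong (λ n → p ^ suc i * k + (ρ / E % p + n * p)) ρ/E/p≡ρ/D ⟩
        p ^ suc i * k + (ρ / E % p + ρ / D * p)      ≡⟨ regroup p (p ^ i) k (ρ / E % p) (ρ / D) ⟩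
        p * (p ^ i * k + ρ / D) + ρ / E % p          ≡⟨ cong₂ (λ b d → p * b + d) (β-closed (<⇒≤ (s≤s i≤F))) digit≡ ⟨
        p * β i + digit h γ' i                       ∎
        where
        open ≡-Reasoning
        E D : ℕ
        E = p ^ (F ∸ i)
        D = p ^ (f ∸ i)
        instance
          E≢0 : NonZero E
          E≢0 = m^n≢0 p (F ∸ i)
          D≢0 : NonZero D
          D≢0 = m^n≢0 p (f ∸ i)
          Ep≢0 : NonZero (E * p)
          Ep≢0 = m*n≢0 E p
        ρ/E/p≡ρ/D : ρ / E / p ≡ ρ / D
        ρ/E/p≡ρ/D = trans (m/n/o≡m/[n*o] ρ E p)
                          (/-congʳ (trans (*-comm E p) (cong (p ^_) (sym (+-∸-assoc 1 i≤F)))))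
        digit≡ : digit h γ' i ≡ ρ / E % p
        digit≡ = cong (_% p) (divℕ≡/ ρ E)
        regroup : ∀ p a k r b → p * a * k + (r + b * p) ≡ p * (a * k + b) + r
        regroup = solve-∀

      hh-low : ∀ {i} → i < f → hh h γ' i ≡ digit h γ' i
      hh-low {i} i<f = trans (cong (hh₀ h γ') (m<n⇒m%n≡m (<f⇒<2f i<f)))
                             (if-true (<⇒<ᵇ i<f))

      hh-high : ∀ {i} → i < f → hh h γ' (i + f) ≡ P ∸ digit h γ' i
      hh-high {i} i<f = begin
        hh₀ h γ' ((i + f) % (2 * f))          ≡⟨ cong (hh₀ h γ') (m<n⇒m%n≡m (<f⇒+f<2f i<f)) ⟩
        hh₀ h γ' (i + f)                      ≡⟨ if-false (λ t → <⇒≱ (<ᵇ⇒< (i + f) f t) (m≤n+m f i)) ⟩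
        P ∸ digit h γ' (i + f ∸ f)            ≡⟨ cong (λ j → P ∸ digit h γ' j) (m+n∸n≡m i f) ⟩
        P ∸ digit h γ' i                      ∎
        where open ≡-Reasoning

      hh-wrap : ∀ i → hh h γ' (i + f + f) ≡ hh h γ' i
      hh-wrap i = cong (hh₀ h γ') (trans (cong (_% (2 * f)) (regroup i f)) ([m+kn]%n≡m%n i 1 (2 * f)))
        where
        regroup : ∀ i f → i + f + f ≡ i + 1 * (2 * f)
        regroup = solve-∀

      hh-complement : ∀ {i} → i < f → hh h γ' i + hh h γ' (i + f) ≡ P
      hh-complement {i} i<f = trans (cong₂ _+_ (hh-low i<f) (hh-high i<f))
                                    (m+[n∸m]≡n (s≤s⁻¹ (m%n<n (ρ divℕ p ^ (F ∸ i)) p)))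

      β-step-low : ∀ {i} → i < f → β (suc i) ≡ p * β i + hh h γ' i
      β-step-low {i} i<f = trans (β-digit-step i<f) (cong (λ d → p * β i + d) (sym (hh-low i<f)))

      β-step-high : ∀ {i} → i < f → β (suc (i + f)) ≡ p * β (i + f) + hh h γ' (i + f)
      β-step-high {i} i<f = +-cancelʳ-≡ (p * β i + c + 1) _ _ (begin
        Y + (p * β i + c + 1)                 ≡⟨ cong (λ n → Y + (n + 1)) (β-step-low i<f) ⟨
        Y + (β (suc i) + 1)                   ≡⟨ +-assoc Y (β (suc i)) 1 ⟨
        Y + β (suc i) + 1                     ≡⟨ β-complement i<f ⟩
        p ^ suc i * h                         ≡⟨ *-assoc p (p ^ i) h ⟩
        p * (p ^ i * h)                       ≡⟨ cong (λ n → p * n) (β-complement (<⇒≤ i<f)) ⟨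
        p * (β (i + f) + β i + 1)             ≡⟨ cong (λ n → suc n * (β (i + f) + β i + 1)) (hh-complement i<f) ⟨
        suc (c + c′) * (β (i + f) + β i + 1)  ≡⟨ expand c c′ (β (i + f)) (β i) ⟩
        suc (c + c′) * β (i + f) + c′ + (suc (c + c′) * β i + c + 1)
          ≡⟨ cong (λ n → suc n * β (i + f) + c′ + (suc n * β i + c + 1)) (hh-complement i<f) ⟩
        p * β (i + f) + c′ + (p * β i + c + 1)  ∎)
        where
        open ≡-Reasoning
        c c′ Y : ℕ
        c = hh h γ' i
        c′ = hh h γ' (i + f)
        Y = β (suc (i + f))
        expand : ∀ c c′ y b → suc (c + c′) * (y + b + 1) ≡ suc (c + c′) * y + c′ + (suc (c + c′) * b + c + 1)
        expand = solve-∀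

      x m : ℕ → ℤ
      x i = + β i -ᶻ + (p ^ i * γ')
      m i = x i ℤD./ℕ K

      x≡α+mK : ∀ i → x i ≡ + α h γ' i +ᶻ m i *ᶻ + K
      x≡α+mK i = subst (λ r → x i ≡ + r +ᶻ m i *ᶻ + K) (sym (modℤ≡%ℕ (x i) K))
                       (ℤD.a≡a%ℕn+[a/ℕn]*n (x i) K)

      α≡x-mK : ∀ i → + α h γ' i ≡ x i -ᶻ m i *ᶻ + K
      α≡x-mK i = trans (cancel (+ α h γ' i) (m i *ᶻ + K)) (cong (_-ᶻ m i *ᶻ + K) (sym (x≡α+mK i)))
        where
        cancel : ∀ a b → a ≡ (a +ᶻ b) -ᶻ b
        cancel = solveᶻ

      α<K : ∀ i → α h γ' i < K
      α<K i = subst (_< K) (sym (modℤ≡%ℕ (x i) K)) (ℤD.n%ℕd<d (x i) K)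

      ε : ℕ → ℤ
      ε i = m (suc i) -ᶻ + p *ᶻ m i

      α-step : ∀ i c → β (suc i) ≡ p * β i + c →
               + α h γ' (suc i) ≡ + (p * α h γ' i + c) -ᶻ + K *ᶻ ε i
      α-step i c step = begin
        + α h γ' (suc i)                                    ≡⟨ α≡x-mK (suc i) ⟩
        x (suc i) -ᶻ m (suc i) *ᶻ + K                        ≡⟨ cong₂ (λ b g → b -ᶻ g -ᶻ m (suc i) *ᶻ + K) β′≡ γ′≡ ⟩
        (+ p *ᶻ + β i +ᶻ + c) -ᶻ + p *ᶻ + (p ^ i * γ') -ᶻ m (suc i) *ᶻ + K
          ≡⟨ factor (+ p) (+ β i) (+ (p ^ i * γ')) (+ c) (m (suc i) *ᶻ + K) ⟩
        + p *ᶻ x i +ᶻ + c -ᶻ m (suc i) *ᶻ + K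
          ≡⟨ cong (λ y → + p *ᶻ y +ᶻ + c -ᶻ m (suc i) *ᶻ + K) (x≡α+mK i) ⟩
        + p *ᶻ (+ α h γ' i +ᶻ m i *ᶻ + K) +ᶻ + c -ᶻ m (suc i) *ᶻ + K
          ≡⟨ regroup (+ p) (+ α h γ' i) (m i) (m (suc i)) (+ K) (+ c) ⟩
        + p *ᶻ + α h γ' i +ᶻ + c -ᶻ + K *ᶻ ε i              ≡⟨ cong (_-ᶻ + K *ᶻ ε i) (pos-*+ p (α h γ' i) c) ⟨
        + (p * α h γ' i + c) -ᶻ + K *ᶻ ε i                  ∎
        where
        open ≡-Reasoning
        β′≡ : + β (suc i) ≡ + p *ᶻ + β i +ᶻ + c
        β′≡ = trans (cong +_ step) (pos-*+ p (β i) c)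
        γ′≡ : + (p ^ suc i * γ') ≡ + p *ᶻ + (p ^ i * γ')
        γ′≡ = trans (cong +_ (*-assoc p (p ^ i) γ')) (ℤP.pos-* p (p ^ i * γ'))
        factor : ∀ z b g c r → (z *ᶻ b +ᶻ c) -ᶻ z *ᶻ g -ᶻ r ≡ z *ᶻ (b -ᶻ g) +ᶻ c -ᶻ r
        factor = solveᶻ
        regroup : ∀ z a m m′ k c →
                  z *ᶻ (a +ᶻ m *ᶻ k) +ᶻ c -ᶻ m′ *ᶻ k ≡ z *ᶻ a +ᶻ c -ᶻ k *ᶻ (m′ -ᶻ z *ᶻ m)
        regroup = solveᶻ

      ε≡carry : ∀ i → hh h γ' i + hh h γ' (i + f) ≡ P → β (suc i) ≡ p * β i + hh h γ' i →
                X₀ h γ' i ≢ O → ε i ≡ symbolCarry (X₀ h γ' i)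
      ε≡carry i complement step ≢O = carry-of-range (X₀ h γ' i) (ε i)
        (classify-range (α h γ' i) (hh h γ' i) (hh h γ' (i + f)) complement ≢O)
        (α<K (suc i)) (α-step i (hh h γ' i) step)

      Matched : ℕ → Set
      Matched i = X₀ h γ' i ≢ O × X₀ h γ' i ≡ X₀ h γ' (i + f)

      ε-periodic : ∀ {i} → i < f → Matched i → ε i ≡ ε (i + f)
      ε-periodic {i} i<f (≢O , X≡) = begin
        ε i                            ≡⟨ ε≡carry i (hh-complement i<f) (β-step-low i<f) ≢O ⟩
        symbolCarry (X₀ h γ' i)        ≡⟨ cong symbolCarry X≡ ⟩
        symbolCarry (X₀ h γ' (i + f))  ≡⟨ ε≡carry (i + f) complement′ (β-step-high i<f) (≢O ∘ trans X≡) ⟨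
        ε (i + f)                      ∎
        where
        open ≡-Reasoning
        complement′ : hh h γ' (i + f) + hh h γ' (i + f + f) ≡ P
        complement′ = trans (cong (λ c → hh h γ' (i + f) + c) (hh-wrap i))
                            (trans (+-comm (hh h γ' (i + f)) (hh h γ' i)) (hh-complement i<f))

      m-drift : (∀ {j} → j < f → ε j ≡ ε (j + f)) →
                ∀ {j} → j ≤ f → m (j + f) -ᶻ m j ≡ + (p ^ j) *ᶻ (m f -ᶻ m 0)
      m-drift periodic {zero}  _   = sym (ℤP.*-identityˡ (m f -ᶻ m 0))
      m-drift periodic {suc j} j<f = begin
        m (suc j + f) -ᶻ m (suc j)
          ≡⟨ drift-step (+ p) (m j) (m (suc j)) (m (j + f)) (m (suc j + f)) (periodic j<f) ⟩
        + p *ᶻ (m (j + f) -ᶻ m j)             ≡⟨ cong (λ d → + p *ᶻ d) (m-drift periodic (<⇒≤ j<f)) ⟩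
        + p *ᶻ (+ (p ^ j) *ᶻ (m f -ᶻ m 0))    ≡⟨ ℤP.*-assoc (+ p) (+ (p ^ j)) (m f -ᶻ m 0) ⟨
        + p *ᶻ + (p ^ j) *ᶻ (m f -ᶻ m 0)      ≡⟨ cong (_*ᶻ (m f -ᶻ m 0)) (ℤP.pos-* p (p ^ j)) ⟨
        + (p ^ suc j) *ᶻ (m f -ᶻ m 0)         ∎
        where open ≡-Reasoning

      x-double : x (f + f) ≡ (+ K *ᶻ + h +ᶻ + β 0) -ᶻ (1ℤ +ᶻ + K) *ᶻ (1ℤ +ᶻ + K) *ᶻ + γ'
      x-double = cong₂ _-ᶻ_ (trans (cong +_ β-double) (pos-*+ K h (β 0))) (begin
        + (p ^ (f + f) * γ')                ≡⟨ cong (λ n → + (n * γ')) (^-distribˡ-+-* p f f) ⟩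
        + (q * q * γ')                      ≡⟨ ℤP.pos-* (q * q) γ' ⟩
        + (q * q) *ᶻ + γ'                   ≡⟨ cong (_*ᶻ + γ') (ℤP.pos-* q q) ⟩
        + q *ᶻ + q *ᶻ + γ'                  ≡⟨ cong (λ n → + n *ᶻ + n *ᶻ + γ') q≡1+K ⟩
        (1ℤ +ᶻ + K) *ᶻ (1ℤ +ᶻ + K) *ᶻ + γ'  ∎)
        where open ≡-Reasoning

      -- From β (f + f) = K h + β 0 and q ^ 2 = 1 + K (K + 2).
      α-wrap : + α h γ' 0 ≡
               + α h γ' (f + f) -ᶻ + K *ᶻ ((+ h -ᶻ + suc q *ᶻ + γ') -ᶻ (m (f + f) -ᶻ m 0))
      α-wrap = begin
        + α h γ' 0                                 ≡⟨ α≡x-mK 0 ⟩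
        x 0 -ᶻ m 0 *ᶻ + K                          ≡⟨ cong (λ n → + β 0 -ᶻ + n -ᶻ m 0 *ᶻ + K) (*-identityˡ γ') ⟩
        (+ β 0 -ᶻ + γ') -ᶻ m 0 *ᶻ + K              ≡⟨ identity (+ K) (+ h) (+ β 0) (+ γ') (m 0) m₂ ⟩
        ((+ K *ᶻ + h +ᶻ + β 0) -ᶻ (1ℤ +ᶻ + K) *ᶻ (1ℤ +ᶻ + K) *ᶻ + γ' -ᶻ m₂ *ᶻ + K)
          -ᶻ + K *ᶻ ((+ h -ᶻ (+ 2 +ᶻ + K) *ᶻ + γ') -ᶻ (m₂ -ᶻ m 0))
          ≡⟨ cong₂ (λ y s → y -ᶻ m₂ *ᶻ + K -ᶻ + K *ᶻ ((+ h -ᶻ s *ᶻ + γ') -ᶻ (m₂ -ᶻ m 0)))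
                   x-double (cong (λ n → + suc n) q≡1+K) ⟨
        (x (f + f) -ᶻ m₂ *ᶻ + K) -ᶻ + K *ᶻ Z       ≡⟨ cong (_-ᶻ + K *ᶻ Z) (α≡x-mK (f + f)) ⟨
        + α h γ' (f + f) -ᶻ + K *ᶻ Z               ∎
        where
        open ≡-Reasoning
        m₂ Z : ℤ
        m₂ = m (f + f)
        Z = (+ h -ᶻ + suc q *ᶻ + γ') -ᶻ (m₂ -ᶻ m 0)
        identity : ∀ k h b g m₀ m₂ →
                   (b -ᶻ g) -ᶻ m₀ *ᶻ k ≡
                   ((k *ᶻ h +ᶻ b) -ᶻ (1ℤ +ᶻ k) *ᶻ (1ℤ +ᶻ k) *ᶻ g -ᶻ m₂ *ᶻ k)
                     -ᶻ k *ᶻ ((h -ᶻ (+ 2 +ᶻ k) *ᶻ g) -ᶻ (m₂ -ᶻ m₀))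
        identity = solveᶻ

      m-wrap : m (f + f) -ᶻ m 0 ≡ + h -ᶻ + suc q *ᶻ + γ'
      m-wrap = begin
        m (f + f) -ᶻ m 0  ≡⟨ unwind H (m (f + f) -ᶻ m 0) ⟩
        H -ᶻ Z            ≡⟨ cong (H -ᶻ_) (carry-zero Z (α<K 0) (α<K (f + f)) α-wrap) ⟩
        H -ᶻ 0ℤ           ≡⟨ ℤP.+-identityʳ H ⟩
        H                 ∎
        where
        open ≡-Reasoning
        H Z : ℤ
        H = + h -ᶻ + suc q *ᶻ + γ'
        Z = H -ᶻ (m (f + f) -ᶻ m 0)
        unwind : ∀ a b → b ≡ a -ᶻ (a -ᶻ b)
        unwind = solveᶻ

      no-full-match : ¬ (∀ {i} → i < f → Matched i)
      no-full-match matched = q+1∤h (divides ℤ.∣ W ∣ h≡∣W∣*[1+q])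
        where
        open ≡-Reasoning
        D W : ℤ
        D = m f -ᶻ m 0
        W = + γ' +ᶻ D
        restore : ∀ a b → a ≡ (a -ᶻ b) +ᶻ b
        restore = solveᶻ
        split : ∀ a b c → a -ᶻ c ≡ (a -ᶻ b) +ᶻ (b -ᶻ c)
        split = solveᶻ
        collect : ∀ q d g → (q *ᶻ d +ᶻ d) +ᶻ (1ℤ +ᶻ q) *ᶻ g ≡ (1ℤ +ᶻ q) *ᶻ (g +ᶻ d)
        collect = solveᶻ
        periodic : ∀ {j} → j < f → ε j ≡ ε (j + f)
        periodic j<f = ε-periodic j<f (matched j<f)
        h≡[1+q]W : + h ≡ + suc q *ᶻ W
        h≡[1+q]W = begin
          + h                                          ≡⟨ restore (+ h) (+ suc q *ᶻ + γ') ⟩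
          (+ h -ᶻ + suc q *ᶻ + γ') +ᶻ + suc q *ᶻ + γ'  ≡⟨ cong (_+ᶻ + suc q *ᶻ + γ') m-wrap ⟨
          (m (f + f) -ᶻ m 0) +ᶻ + suc q *ᶻ + γ'        ≡⟨ cong (_+ᶻ + suc q *ᶻ + γ') (split (m (f + f)) (m f) (m 0)) ⟩
          ((m (f + f) -ᶻ m f) +ᶻ D) +ᶻ + suc q *ᶻ + γ' ≡⟨ cong (λ e → (e +ᶻ D) +ᶻ + suc q *ᶻ + γ') (m-drift periodic ≤-refl) ⟩
          (+ q *ᶻ D +ᶻ D) +ᶻ + suc q *ᶻ + γ'           ≡⟨ collect (+ q) D (+ γ') ⟩
          + suc q *ᶻ W                                 ∎
        h≡∣W∣*[1+q] : h ≡ ℤ.∣ W ∣ * suc q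
        h≡∣W∣*[1+q] = trans (cong ℤ.∣_∣ h≡[1+q]W) (trans (ℤP.abs-* (+ suc q) W) (*-comm (suc q) ℤ.∣ W ∣))

      X-window : ∀ {n} → n < 2 * f → X h γ' (+ n) ≡ X₀ h γ' n
      X-window n<2f = cong (X₀ h γ') (m<n⇒m%n≡m n<2f)

      defect : ∃[ i ] (X h γ' i ≡ O ⊎ X h γ' i ≢ X h γ' (i +ᶻ + f))
      defect with anyUpTo? (λ i → (X₀ h γ' i ≟ˢ O) ⊎-dec ¬? (X₀ h γ' i ≟ˢ X₀ h γ' (i + f))) f
      ... | yes (i , i<f , found) =
        + i , subst₂ (λ s t → s ≡ O ⊎ s ≢ t) (sym (X-window (<f⇒<2f i<f))) (sym (X-window (<f⇒+f<2f i<f))) found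
      ... | no none = ⊥-elim (no-full-match matched)
        where
        matched : ∀ {i} → i < f → Matched i
        matched {i} i<f = (λ X≡O → none (i , i<f , inj₁ X≡O))
                        , decidable-stable (X₀ h γ' i ≟ˢ X₀ h γ' (i + f)) (λ X≢ → none (i , i<f , inj₂ X≢))

open import Data.Nat using (ℕ; _<_; _≤_)
open import Data.Nat.Primality using (Prime)
open import Data.Integer using (ℤ; +_; _+_)
open import Data.Product using (∃-syntax)
open import Data.Sum using (_⊎_)
open import Relation.Binary.PropositionalEquality using (_≡_; _≢_)
open import Data.Nat using (suc; s≤s)
open import Data.Product using (_,_)

corollary1p3p4 : (p f h γ γ' : ℕ) → Prime p → 2 < p → 2 ≤ f →
    Gene.Coherent p f h γ γ' →
    ∃[ i ] (Gene.X p f h γ' i ≡ Gene.O ⊎ Gene.X p f h γ' i ≢ Gene.X p f h γ' (i + + f))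
corollary1p3p4 (suc P) (suc F) h γ γ' _ (s≤s 2≤P) (s≤s 1≤F) (_ , _ , _ , q+1∤h , _) =
  GeneCarries.defect P F 2≤P 1≤F h γ' q+1∤h
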